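{- There exists a finite geometric lattice $L$ for which the diamond product on $\mathbb{R}[L]$ is not associative; that is, there are $x,y,z\in L$ with $(x\diamond y)\diamond z\neq x\diamond(y\diamond z)$.
   Context: For a finite lattice $L$ with bottom element $0$, let $\mathbb{R}[L]$ be the real vector space with basis $\{e_x : x\in L\}$ (basis vectors identified with lattice elements). The diamond product is the bilinear product on $\mathbb{R}[L]$ defined on basis elements by $x\diamond y = x\vee y$ if $x\wedge y=0$, and $x\diamond y=0$ (the zero vector) if $x\wedge y\neq 0$. -}

module Defs where

open import Level using (0ℓ)
open import Data.Nat using (ℕ)
open import Data.Fin using (Fin)
open import Data.Product using (Σ; ∃; _×_)
open import Data.Maybe using (Maybe; just; nothing)
open import Data.Unit using () renaming (⊤ to Unit)
open import Data.Empty using () renaming (⊥ to Empty)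
open import Relation.Nullary using (¬_; yes; no)
open import Relation.Binary.Definitions using (Decidable)
open import Relation.Binary.Lattice.Bundles using (BoundedLattice)
open import Function.Bundles using (Bijection)
import Relation.Binary.PropositionalEquality as ≡

module _ (L : BoundedLattice 0ℓ 0ℓ 0ℓ) where
  open BoundedLattice L

  _<ₗ_ : Carrier → Carrier → Set
  a <ₗ b = (a ≤ b) × ¬ (a ≈ b)

  Covers : Carrier → Carrier → Set
  Covers a b = (a <ₗ b) × (∀ c → a <ₗ c → ¬ (c <ₗ b))

  IsAtom : Carrier → Set
  IsAtom a = Covers ⊥ a

  -- atomistic: every element is the join (least upper bound) of the atoms below it
  Atomistic : Set
  Atomistic = ∀ x u → (∀ a → IsAtom a → a ≤ x → a ≤ u) → x ≤ u

  Semimodular : Set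
  Semimodular = ∀ a b → Covers (a ∧ b) a → Covers b (a ∨ b)

  Finite : Set
  Finite = ∃ λ n → Bijection (≡.setoid (Fin n)) setoid

-- A finite geometric lattice = finite, atomistic, semimodular lattice.
-- (Finite lattices are bounded, so BoundedLattice loses nothing.)
-- Decidable equality is included as data; it follows from finiteness anyway.
record FiniteGeometricLattice : Set₁ where
  field
    lat         : BoundedLattice 0ℓ 0ℓ 0ℓ
  open BoundedLattice lat public
  field
    finite      : Finite lat
    _≟_         : Decidable _≈_
    atomistic   : Atomistic lat
    semimodular : Semimodular lat

  -- Elements of ℝ[L] that are either the zero vector (nothing) or a basis
  -- vector e_x (just x). This set is closed under the diamond product on
  -- basis vectors extended bilinearly, so it suffices to compute (x⋄y)⋄z.
  BasisOrZero : Set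
  BasisOrZero = Maybe Carrier

  -- equality of such vectors in ℝ[L]: basis vectors are nonzero and distinct
  _≈ᵥ_ : BasisOrZero → BasisOrZero → Set
  nothing ≈ᵥ nothing = Unit
  just a  ≈ᵥ just b  = a ≈ b
  nothing ≈ᵥ just _  = Empty
  just _  ≈ᵥ nothing = Empty

  -- diamond product: x ⋄ y = x ∨ y if x ∧ y = 0, else the zero vector;
  -- bilinearity gives 0 ⋄ v = v ⋄ 0 = 0.
  _⋄_ : BasisOrZero → BasisOrZero → BasisOrZero
  just x ⋄ just y with (x ∧ y) ≟ ⊥
  ... | yes _ = just (x ∨ y)
  ... | no  _ = nothing
  nothing ⋄ _ = nothing
  just _ ⋄ nothing = nothing

{-# OPTIONS --safe #-}

-- The counterexample is the lattice of flats of the uniform matroid U₃,₄: four points in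
-- general position in the plane, any two spanning a line and any three the whole plane.
-- Like every lattice of flats it is geometric, which for these twelve elements is checked
-- exhaustively. The points 0 and 1 meet in the bottom, so 0 ⋄ 1 is the line 01, which
-- meets the line 23 in the bottom, giving (0 ⋄ 1) ⋄ 23 = ⊤. But 1 ⋄ 23 = ⊤ already, and
-- ⊤ meets the point 0 nontrivially, so 0 ⋄ (1 ⋄ 23) = 0.
module Submission where

open import Level using (0ℓ)
import Data.Bool as Bool
open import Data.Nat using (ℕ; zero; suc; _<_; _<?_)
open import Data.Nat.Properties using (≤-<-trans)
open import Data.Fin using (Fin; #_)
import Data.Fin.Properties as Fin
open import Data.Fin.Subset using (Subset; _⊆_; _∪_; _∩_; ⊤; ⊥; ⁅_⁆; ∣_∣; inside; outside)
open import Data.Fin.Subset.Properties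
  using (⊆-isPartialOrder; _⊆?_; ⊆-refl; ⊆-trans; ⊆⊤; ⊥⊆; p⊆p∪q; q⊆p∪q; x∈p∪q⁻; p∩q⊆p; p∩q⊆q; x∈p∩q⁺; p⊆q⇒∣p∣≤∣q∣)
open import Data.Vec using (Vec; []; _∷_; lookup)
open import Data.Vec.Properties using (≡-dec)
open import Data.Product using (∃; Σ-syntax; _,_)
open import Data.Sum using ([_,_])
open import Data.Maybe using (just)
open import Function using (_∘_)
open import Relation.Nullary using (¬_; Dec; yes; no; contradiction)
open import Relation.Nullary.Decidable using (toWitness; map′; _×-dec_; _→-dec_; ¬?)
open import Relation.Unary using (Pred)
open import Relation.Binary using (Rel; Decidable)
open import Relation.Binary.PropositionalEquality using (_≡_; refl; subst)
import Relation.Binary.Construct.On as On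
open import Relation.Binary.Lattice.Bundles using (BoundedLattice)
open import Defs

allSubset? : ∀ {n} {P : Pred (Subset n) 0ℓ} → (∀ p → Dec (P p)) → Dec (∀ p → P p)
allSubset? {zero} P? = map′ (λ { P[] [] → P[] }) (λ ∀P → ∀P []) (P? [])
allSubset? {suc n} P? =
  map′ (λ { (∀P-in , ∀P-out) (inside ∷ p) → ∀P-in p ; (∀P-in , ∀P-out) (outside ∷ p) → ∀P-out p })
       (λ ∀P → (λ p → ∀P (inside ∷ p)) , (λ p → ∀P (outside ∷ p)))
       (allSubset? (P? ∘ (inside ∷_)) ×-dec allSubset? (P? ∘ (outside ∷_)))

module _ {n} {p q r : Subset n} where

  ∪-least : p ⊆ r → q ⊆ r → p ∪ q ⊆ r
  ∪-least p⊆r q⊆r = [ p⊆r , q⊆r ] ∘ x∈p∪q⁻ p q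

  ∩-greatest : r ⊆ p → r ⊆ q → r ⊆ p ∩ q
  ∩-greatest r⊆p r⊆q x∈r = x∈p∩q⁺ (r⊆p x∈r , r⊆q x∈r)

record IsClosureOperator {n} (cl : Subset n → Subset n) : Set where
  field
    extensive  : ∀ p → p ⊆ cl p
    monotone   : ∀ {p q} → p ⊆ q → cl p ⊆ cl q
    idempotent : ∀ p → cl (cl p) ≡ cl p

  cl-least : ∀ {p q} → p ⊆ cl q → cl p ⊆ cl q
  cl-least {p} {q} p⊆clq = subst (cl p ⊆_) (idempotent q) (monotone p⊆clq)

-- A closed set is represented by any subset spanning it (p ≈ q iff cl p ≡ cl q), so the
-- carrier is all of Subset n and no closedness proofs have to be carried around.
module LatticeOfClosedSets {n} {cl : Subset n → Subset n} (isClosure : IsClosureOperator cl) where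
  open IsClosureOperator isClosure

  _≈_ : Rel (Subset n) 0ℓ
  p ≈ q = cl p ≡ cl q

  _≤_ : Rel (Subset n) 0ℓ
  p ≤ q = cl p ⊆ cl q

  closedSets : BoundedLattice 0ℓ 0ℓ 0ℓ
  closedSets = record
    { Carrier = Subset n ; _≈_ = _≈_ ; _≤_ = _≤_
    ; _∨_ = _∪_ ; _∧_ = λ p q → cl p ∩ cl q ; ⊤ = ⊤ ; ⊥ = ⊥
    ; isBoundedLattice = record
      { isLattice = record
        { isPartialOrder = On.isPartialOrder cl (⊆-isPartialOrder n)
        ; supremum = λ p q →
            monotone (p⊆p∪q q) , monotone (q⊆p∪q p q) , λ r p≤r q≤r →
            cl-least (∪-least (⊆-trans (extensive p) p≤r) (⊆-trans (extensive q) q≤r))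
        ; infimum = λ p q →
            cl-least (p∩q⊆p (cl p) (cl q)) , cl-least (p∩q⊆q (cl p) (cl q)) , λ r r≤p r≤q →
            ⊆-trans (∩-greatest r≤p r≤q) (extensive (cl p ∩ cl q))
        }
      ; maximum = λ p → monotone ⊆⊤
      ; minimum = λ p → monotone ⊥⊆
      }
    }

  _≟_ : Decidable _≈_
  p ≟ q = ≡-dec Bool._≟_ (cl p) (cl q)

  _≤?_ : Decidable _≤_
  p ≤? q = cl p ⊆? cl q

module DecideGeometric (L : BoundedLattice 0ℓ 0ℓ 0ℓ)
  (_≟_ : Decidable (BoundedLattice._≈_ L)) (_≤?_ : Decidable (BoundedLattice._≤_ L))
  (all? : ∀ {P : Pred (BoundedLattice.Carrier L) 0ℓ} → (∀ x → Dec (P x)) → Dec (∀ x → P x)) where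

  open BoundedLattice L hiding (⊤; ⊥)

  _<ₗ?_ : Decidable (_<ₗ_ L)
  a <ₗ? b = (a ≤? b) ×-dec ¬? (a ≟ b)

  covers? : Decidable (Covers L)
  covers? a b = (a <ₗ? b) ×-dec all? λ c → (a <ₗ? c) →-dec ¬? (c <ₗ? b)

  isAtom? : ∀ a → Dec (IsAtom L a)
  isAtom? = covers? (BoundedLattice.⊥ L)

  semimodular? : Dec (Semimodular L)
  semimodular? = all? λ a → all? λ b → covers? (a ∧ b) a →-dec covers? b (a ∨ b)

  atomistic? : Dec (Atomistic L)
  atomistic? = all? λ x → all? λ u →
    (all? λ a → isAtom? a →-dec (a ≤? x) →-dec (a ≤? u)) →-dec (x ≤? u)

uniformClosure : ∀ {n} → ℕ → Subset n → Subset n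
uniformClosure r p with ∣ p ∣ <? r
... | yes _ = p
... | no  _ = ⊤

module _ {n : ℕ} (r : ℕ) where

  uniformClosure-small : ∀ {p : Subset n} → ∣ p ∣ < r → uniformClosure r p ≡ p
  uniformClosure-small {p} small with ∣ p ∣ <? r
  ... | yes _     = refl
  ... | no  large = contradiction small large

  uniformClosure-⊤ : uniformClosure r ⊤ ≡ ⊤ {n}
  uniformClosure-⊤ with ∣ ⊤ {n} ∣ <? r
  ... | yes _ = refl
  ... | no  _ = refl

  uniformClosure-isClosureOperator : IsClosureOperator (uniformClosure r)
  uniformClosure-isClosureOperator = record
    { extensive = extensive ; monotone = monotone ; idempotent = idempotent }
    where
    extensive : ∀ p → p ⊆ uniformClosure r p
    extensive p with ∣ p ∣ <? r
    ... | yes _ = ⊆-refl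
    ... | no  _ = ⊆⊤

    monotone : ∀ {p q} → p ⊆ q → uniformClosure r p ⊆ uniformClosure r q
    monotone {p} {q} p⊆q with ∣ p ∣ <? r | ∣ q ∣ <? r
    ... | _        | no _      = ⊆⊤
    ... | yes _    | yes _     = p⊆q
    ... | no large | yes small = contradiction (≤-<-trans (p⊆q⇒∣p∣≤∣q∣ p⊆q) small) large

    idempotent : ∀ p → uniformClosure r (uniformClosure r p) ≡ uniformClosure r p
    idempotent p with ∣ p ∣ <? r
    ... | yes small = uniformClosure-small small
    ... | no  _     = uniformClosure-⊤

open LatticeOfClosedSets (uniformClosure-isClosureOperator {4} 3)
open DecideGeometric closedSets _≟_ _≤?_ allSubset?

line : Fin 4 → Fin 4 → Subset 4
line i j = ⁅ i ⁆ ∪ ⁅ j ⁆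

flatsU₃,₄ : Vec (Subset 4) 12
flatsU₃,₄ = ⊥ ∷ ⁅ # 0 ⁆ ∷ ⁅ # 1 ⁆ ∷ ⁅ # 2 ⁆ ∷ ⁅ # 3 ⁆
          ∷ line (# 0) (# 1) ∷ line (# 0) (# 2) ∷ line (# 0) (# 3)
          ∷ line (# 1) (# 2) ∷ line (# 1) (# 3) ∷ line (# 2) (# 3) ∷ ⊤ ∷ []

finiteU₃,₄ : Finite closedSets
finiteU₃,₄ = 12 , record
  { to = lookup flatsU₃,₄
  ; cong = λ { refl → refl }
  ; bijective = (λ {i} {j} → injective i j) , λ p → let i , i≈p = surjective p in i , λ { refl → i≈p }
  }
  where
  injective : ∀ i j → lookup flatsU₃,₄ i ≈ lookup flatsU₃,₄ j → i ≡ j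
  injective = toWitness {a? = Fin.all? λ i → Fin.all? λ j →
    (lookup flatsU₃,₄ i ≟ lookup flatsU₃,₄ j) →-dec (i Fin.≟ j)} _

  surjective : ∀ p → ∃ λ i → lookup flatsU₃,₄ i ≈ p
  surjective = toWitness {a? = allSubset? λ p → Fin.any? λ i → lookup flatsU₃,₄ i ≟ p} _

U₃,₄ : FiniteGeometricLattice
U₃,₄ = record
  { lat = closedSets
  ; finite = finiteU₃,₄
  ; _≟_ = _≟_
  ; atomistic = toWitness {a? = atomistic?} _
  ; semimodular = toWitness {a? = semimodular?} _
  }

proposition2p6 : Σ[ G ∈ FiniteGeometricLattice ] let open FiniteGeometricLattice G in ∃ λ x → ∃ λ y → ∃ λ z → ¬ (((just x ⋄ just y) ⋄ just z) ≈ᵥ (just x ⋄ (just y ⋄ just z)))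
proposition2p6 = U₃,₄ , ⁅ # 0 ⁆ , ⁅ # 1 ⁆ , line (# 2) (# 3) , λ ()
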